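{- Let $\Phi=\frac{1+\sqrt5}{2}$ and let $p,q\in\mathbb{N}$ with $1<\frac{q}{p}<\Phi$ such that $(p,q)$ is not a splitting pair. Then the set of $P$-positions of $(p,q)\mathrm{GDWN}$ equals the set of $P$-positions of Wythoff Nim, namely $\{(\lfloor n\Phi\rfloor,\lfloor n\Phi^2\rfloor),(\lfloor n\Phi^2\rfloor,\lfloor n\Phi\rfloor)\mid n\in\mathbb{N}_0\}$.
   Context: A pair $(p,q)$ of positive integers is a splitting pair if there is $n\in\mathbb{N}$ with $(p,q)=(\lfloor n\Phi\rfloor,\lfloor n\Phi^2\rfloor)$ (a Wythoff pair) or $(p,q)=(\lfloor n\Phi\rfloor+1,\lfloor n\Phi^2\rfloor+1)$ (a dual Wythoff pair). The game $(p,q)\mathrm{GDWN}$ is played on $(x,y)\in\mathbb{N}_0^2$; a move goes to $(x-m,y-n)\in\mathbb{N}_0^2$ where $(m,n)\in\{(0,t),(t,0),(t,t),(tp,tq),(tq,tp)\}$ for some $t\in\mathbb{N}$. Wythoff Nim is the same game with only the moves $(0,t),(t,0),(t,t)$. In both, the player unable to move loses; a position is a $P$-position if none of its options is a $P$-position. -}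

module Defs where

open import Data.Nat using (ℕ; zero; suc; _+_; _*_; _∸_; _≤_; _<_)
open import Data.Product using (Σ; ∃; _×_; _,_)
open import Data.Sum using (_⊎_)
open import Relation.Binary.PropositionalEquality using (_≡_)

-- Real numbers are not available; we express floors of (k·n + n·√5)/2 by
-- their defining inequalities, squared (all quantities involved are ≥ 0).
-- FloorHalf k n a  :⇔  a ≤ (k·n + n·√5)/2 < a + 1
--   a ≤ (kn + n√5)/2   ⇔  2a − kn ≤ n√5   ⇔  (2a ∸ kn)² ≤ 5n²
--   (kn + n√5)/2 < a+1 ⇔  n√5 < 2a + 2 − kn ⇔  5n² < (2a + 2 ∸ kn)²
FloorHalf : ℕ → ℕ → ℕ → Set
FloorHalf k n a =
  ((2 * a ∸ k * n) * (2 * a ∸ k * n) ≤ 5 * (n * n)) ×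
  (5 * (n * n) < (2 * a + 2 ∸ k * n) * (2 * a + 2 ∸ k * n))

-- a = ⌊ n Φ ⌋   where Φ = (1 + √5)/2
FloorNPhi : ℕ → ℕ → Set
FloorNPhi n a = FloorHalf 1 n a

-- b = ⌊ n Φ² ⌋  where Φ² = (3 + √5)/2
FloorNPhi2 : ℕ → ℕ → Set
FloorNPhi2 n b = FloorHalf 3 n b

-- q < p Φ  ⇔  2q − p < p√5  ⇔  (2q ∸ p)² < 5p²
LtTimesPhi : ℕ → ℕ → Set
LtTimesPhi q p = (2 * q ∸ p) * (2 * q ∸ p) < 5 * (p * p)

SplittingPair : ℕ → ℕ → Set
SplittingPair p q = Σ ℕ λ n → 1 ≤ n × Σ ℕ λ a → Σ ℕ λ b →
  FloorNPhi n a × FloorNPhi2 n b ×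
  ((p ≡ a × q ≡ b) ⊎ (p ≡ suc a × q ≡ suc b))

Rule : Set₁
Rule = ℕ → ℕ → Set

WythoffMove : Rule
WythoffMove m n = Σ ℕ λ t → 1 ≤ t ×
  ((m ≡ 0 × n ≡ t) ⊎ (m ≡ t × n ≡ 0) ⊎ (m ≡ t × n ≡ t))

GDWNMove : ℕ → ℕ → Rule
GDWNMove p q m n = WythoffMove m n ⊎ (Σ ℕ λ t → 1 ≤ t ×
  ((m ≡ t * p × n ≡ t * q) ⊎ (m ≡ t * q × n ≡ t * p)))

Option : Rule → ℕ → ℕ → ℕ → ℕ → Set
Option R x y x' y' = Σ ℕ λ m → Σ ℕ λ n → R m n × x ≡ x' + m × y ≡ y' + n

-- P-positions (no option is a P-position) and N-positions, defined inductively
-- (the games are well-founded, so this is the usual recursive definition).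
mutual
  data IsP (R : Rule) (x y : ℕ) : Set where
    isP : (∀ x' y' → Option R x y x' y' → IsN R x' y') → IsP R x y

  data IsN (R : Rule) (x y : ℕ) : Set where
    isN : ∀ x' y' → Option R x y x' y' → IsP R x' y' → IsN R x y

WythoffPairs : ℕ → ℕ → Set
WythoffPairs x y = Σ ℕ λ n → Σ ℕ λ a → Σ ℕ λ b →
  FloorNPhi n a × FloorNPhi2 n b × ((x ≡ a × y ≡ b) ⊎ (x ≡ b × y ≡ a))

-- All real-number reasoning takes place in ℤ[√5], where A + B√5 ≥ 0 is decided by comparing
-- A² with 5B²; the irrationality of √5 turns the non-strict inequalities this yields into
-- strict ones. The Wythoff positions (⌊nΦ⌋, ⌊nΦ⌋ + n) and their mirror images then form the
-- kernel of the GDWN game: from every other position a single Wythoff Nim move reaches one of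
-- them, and by Beatty's theorem for Φ and Φ² no Wythoff Nim move joins two of them. A move
-- (tp, tq) joining two of them contradicts p < q or q < pΦ, except when both lie above the
-- diagonal; there the floor estimates give p − 1 ≤ jΦ for j = q − p, while q < pΦ is jΦ < p,
-- so (p, q) would be the dual Wythoff pair (⌊jΦ⌋ + 1, ⌊jΦ²⌋ + 1).

module Submission where

open import Defs
open import Data.Nat using (ℕ; _≤_; _<_)
open import Relation.Nullary using (¬_)
open import Function.Bundles using (_⇔_)

open import Data.Nat.Base as ℕ using (zero; suc; z≤n; s≤s)
open import Data.Nat.Properties using (_≤?_)
open import Relation.Binary.Definitions using (tri<; tri≈; tri>)
import Data.Nat.Properties as ℕ
open import Data.Nat.Divisibility using (_∣_; divides)
open import Data.Nat.Primality using (prime?; euclidsLemma)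
open import Data.Nat.Induction using (<-wellFounded)
open import Induction.WellFounded using (Acc; acc)
open import Data.Product using (Σ; _×_; _,_; proj₁; proj₂)
open import Data.Sum as Sum using (_⊎_; inj₁; inj₂)
open import Data.Unit using (⊤; tt)
open import Data.Empty using (⊥; ⊥-elim)
open import Function.Base using (_∘_)
open import Function.Bundles using (Equivalence; mk⇔)
open import Function.Properties.Equivalence using () renaming (refl to ⇔-refl; trans to ⇔-trans)
open import Relation.Nullary using (Dec; yes; no)
open import Relation.Nullary.Decidable using (toWitness; map′; decidable-stable)
open import Relation.Binary.PropositionalEquality
import Data.Nat.Tactic.RingSolver as ℕ-Solver

module SquareComparison where
  open import Data.Nat.Base using (_+_; _*_)
  open ℕ-Solver using (solve-∀)

  infix 4 _≤√5*_ _√5*≤_ _≤√5*?_ _√5*≤?_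

  _≤√5*_ : ℕ → ℕ → Set
  x ≤√5* y = x * x ≤ 5 * (y * y)

  _√5*≤_ : ℕ → ℕ → Set
  y √5*≤ x = 5 * (y * y) ≤ x * x

  _≤√5*?_ : ∀ x y → Dec (x ≤√5* y)
  x ≤√5*? y = x * x ≤? 5 * (y * y)

  _√5*≤?_ : ∀ y x → Dec (y √5*≤ x)
  y √5*≤? x = 5 * (y * y) ≤? x * x

  *-self-mono-≤ : ∀ {m n} → m ≤ n → m * m ≤ n * n
  *-self-mono-≤ m≤n = ℕ.*-mono-≤ m≤n m≤n

  m*m≤n*n⇒m≤n : ∀ m n → m * m ≤ n * n → m ≤ n
  m*m≤n*n⇒m≤n m n h with m ≤? n
  ... | yes m≤n = m≤n
  ... | no m≰n = ⊥-elim (ℕ.<⇒≱ (ℕ.*-mono-< n<m n<m) h)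
    where n<m = ℕ.≰⇒> m≰n

  m*m<n*n⇒m<n : ∀ m n → m * m < n * n → m < n
  m*m<n*n⇒m<n m n h with n ≤? m
  ... | yes n≤m = ⊥-elim (ℕ.<⇒≱ h (*-self-mono-≤ n≤m))
  ... | no n≰m = ℕ.≰⇒> n≰m

  ≤√5*-mono : ∀ {x x′ y y′} → x′ ≤ x → y ≤ y′ → x ≤√5* y → x′ ≤√5* y′
  ≤√5*-mono x′≤x y≤y′ h =
    ℕ.≤-trans (*-self-mono-≤ x′≤x) (ℕ.≤-trans h (ℕ.*-monoʳ-≤ 5 (*-self-mono-≤ y≤y′)))

  √5*≤-mono : ∀ {x x′ y y′} → y′ ≤ y → x ≤ x′ → y √5*≤ x → y′ √5*≤ x′
  √5*≤-mono y′≤y x≤x′ h =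
    ℕ.≤-trans (ℕ.*-monoʳ-≤ 5 (*-self-mono-≤ y′≤y)) (ℕ.≤-trans h (*-self-mono-≤ x≤x′))

  private
    square-* : ∀ x z → (x * x) * (z * z) ≡ (x * z) * (x * z)
    square-* = solve-∀

    five-square-* : ∀ y w → (5 * (y * y)) * (5 * (w * w)) ≡ (5 * (y * w)) * (5 * (y * w))
    five-square-* = solve-∀

    square-+ : ∀ x z → (x + z) * (x + z) ≡ x * x + 2 * (x * z) + z * z
    square-+ = solve-∀

    five-square-+ : ∀ y w → 5 * ((y + w) * (y + w)) ≡ 5 * (y * y) + 2 * (5 * (y * w)) + 5 * (w * w)
    five-square-+ = solve-∀

  ≤√5*-* : ∀ x y z w → x ≤√5* y → z ≤√5* w → x * z ≤ 5 * (y * w)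
  ≤√5*-* x y z w h₁ h₂ =
    m*m≤n*n⇒m≤n _ _ (subst₂ _≤_ (square-* x z) (five-square-* y w) (ℕ.*-mono-≤ {x * x} {5 * (y * y)} h₁ h₂))

  √5*≤-* : ∀ x y z w → y √5*≤ x → w √5*≤ z → 5 * (y * w) ≤ x * z
  √5*≤-* x y z w h₁ h₂ =
    m*m≤n*n⇒m≤n _ _ (subst₂ _≤_ (five-square-* y w) (square-* x z) (ℕ.*-mono-≤ {5 * (y * y)} {x * x} h₁ h₂))

  ≤√5*-+ : ∀ x y z w → x ≤√5* y → z ≤√5* w → x + z ≤√5* y + w
  ≤√5*-+ x y z w h₁ h₂ = subst₂ _≤_ (sym (square-+ x z)) (sym (five-square-+ y w))
    (ℕ.+-mono-≤ (ℕ.+-mono-≤ h₁ (ℕ.*-monoʳ-≤ 2 (≤√5*-* x y z w h₁ h₂))) h₂)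

  √5*≤-+ : ∀ x y z w → y √5*≤ x → w √5*≤ z → y + w √5*≤ x + z
  √5*≤-+ x y z w h₁ h₂ = subst₂ _≤_ (sym (five-square-+ y w)) (sym (square-+ x z))
    (ℕ.+-mono-≤ (ℕ.+-mono-≤ h₁ (ℕ.*-monoʳ-≤ 2 (√5*≤-* x y z w h₁ h₂))) h₂)

  -- In both cancellation lemmas, adding the negated conclusion to the first hypothesis
  -- contradicts the second.
  √5*≤-cancelˡ : ∀ x y u v → x ≤√5* y → y + v √5*≤ x + u → v √5*≤ u
  √5*≤-cancelˡ x y u v h₁ h with v √5*≤? u
  ... | yes v≤u = v≤u
  ... | no v≰u = ⊥-elim (ℕ.<⇒≱ sum< h)
    where
    u<v = ℕ.≰⇒> v≰u
    sum< : (x + u) * (x + u) < 5 * ((y + v) * (y + v))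
    sum< = subst₂ _<_ (sym (square-+ x u)) (sym (five-square-+ y v))
      (ℕ.+-mono-≤-< (ℕ.+-mono-≤ h₁ (ℕ.*-monoʳ-≤ 2 (≤√5*-* x y u v h₁ (ℕ.<⇒≤ u<v)))) u<v)

  ≤√5*-cancelˡ : ∀ x y u v → y √5*≤ x → x + u ≤√5* y + v → u ≤√5* v
  ≤√5*-cancelˡ x y u v h₁ h with u ≤√5*? v
  ... | yes u≤v = u≤v
  ... | no u≰v = ⊥-elim (ℕ.<⇒≱ sum< h)
    where
    v<u = ℕ.≰⇒> u≰v
    sum< : 5 * ((y + v) * (y + v)) < (x + u) * (x + u)
    sum< = subst₂ _<_ (sym (five-square-+ y v)) (sym (square-+ x u))
      (ℕ.+-mono-≤-< (ℕ.+-mono-≤ h₁ (ℕ.*-monoʳ-≤ 2 (√5*≤-* x y u v h₁ (ℕ.<⇒≤ v<u)))) v<u)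

  private
    5∣m*m⇒5∣m : ∀ m → 5 ∣ m * m → 5 ∣ m
    5∣m*m⇒5∣m m h with euclidsLemma m m (toWitness {a? = prime? 5} tt) h
    ... | inj₁ 5∣m = 5∣m
    ... | inj₂ 5∣m = 5∣m

    divide-by-5 : ∀ a b → (a * 5) * (a * 5) ≡ 5 * b → b ≡ 5 * (a * a)
    divide-by-5 a b e = ℕ.*-cancelˡ-≡ b (5 * (a * a)) 5 (trans (sym e) (twenty-five a))
      where
      twenty-five : ∀ a → (a * 5) * (a * 5) ≡ 5 * (5 * (a * a))
      twenty-five = solve-∀

    divide-out-5 : ∀ x y → x * x ≡ 5 * (y * y) → Σ ℕ λ z → x ≡ z * 5 × y * y ≡ 5 * (z * z)
    divide-out-5 x y e with 5∣m*m⇒5∣m x (divides (y * y) (trans e (ℕ.*-comm 5 (y * y))))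
    ... | divides z x≡z*5 =
      z , x≡z*5 , divide-by-5 z (y * y) (subst (λ u → u * u ≡ 5 * (y * y)) x≡z*5 e)

    descent-step : ∀ x y → x * x ≡ 5 * (y * y) →
                   Σ ℕ λ z → Σ ℕ λ w → y ≡ w * 5 × z * z ≡ 5 * (w * w)
    descent-step x y e =
      let z , _ , e′ = divide-out-5 x y e ; w , y≡w*5 , e″ = divide-out-5 y z e′ in z , w , y≡w*5 , e″

    mutual
      descent : ∀ y → Acc _<_ y → ∀ x → x * x ≡ 5 * (y * y) → y ≡ 0
      descent y rec x e = descend y rec (descent-step x y e)

      descend : ∀ y → Acc _<_ y → (Σ ℕ λ z → Σ ℕ λ w → y ≡ w * 5 × z * z ≡ 5 * (w * w)) → y ≡ 0
      descend y _ (_ , zero , y≡0 , _) = y≡0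
      descend y (acc smaller) (z , suc w , y≡w*5 , e) =
        ⊥-elim (ℕ.0≢1+n (sym (descent (suc w) (smaller w<y) z e)))
        where w<y = subst (suc w <_) (sym y≡w*5) (ℕ.m<m*n (suc w) 5 (s≤s (s≤s z≤n)))

  -- Infinite descent: x = 5z turns x² = 5y² into y² = 5z², and y = 5w then gives z² = 5w².
  √5-irrational : ∀ x y → x * x ≡ 5 * (y * y) → y ≡ 0
  √5-irrational x y = descent y (<-wellFounded y) x

import Data.Integer.Base as ℤ
import Data.Integer.Properties as ℤ

module ℤ[√5]-Order where
  open import Data.Integer.Base using (ℤ; +_; -[1+_]; _⊖_; _+_; _-_; _*_; -_)
  open import Data.Integer.Tactic.RingSolver using (solve-∀)
  open SquareComparison

  -- NonNeg√5 A B  ⇔  A + B√5 ≥ 0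
  NonNeg√5 : ℤ → ℤ → Set
  NonNeg√5 (+ a)    (+ b)    = ⊤
  NonNeg√5 (+ a)    -[1+ b ] = suc b √5*≤ a
  NonNeg√5 -[1+ a ] (+ b)    = suc a ≤√5* b
  NonNeg√5 -[1+ a ] -[1+ b ] = ⊥

  data ⊖-Cases (m n : ℕ) : ℤ → Set where
    ≥-case : ∀ k → m ≡ n ℕ.+ k → ⊖-Cases m n (+ k)
    <-case : ∀ k → n ≡ m ℕ.+ suc k → ⊖-Cases m n -[1+ k ]

  ⊖-cases : ∀ m n → ⊖-Cases m n (m ⊖ n)
  ⊖-cases m       zero    = ≥-case m refl
  ⊖-cases zero    (suc n) = <-case n refl
  ⊖-cases (suc m) (suc n) =
    subst (⊖-Cases (suc m) (suc n)) (sym (ℤ.[1+m]⊖[1+n]≡m⊖n m n)) (shift (⊖-cases m n))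
    where
    shift : ∀ {i} → ⊖-Cases m n i → ⊖-Cases (suc m) (suc n) i
    shift (≥-case k e) = ≥-case k (cong suc e)
    shift (<-case k e) = <-case k (cong suc e)

  -- add[σ,τ] handles the sign patterns σ of (A, B) and τ of (C, D) in which a ⊖ appears.
  private
    suc≤ : ∀ {k m n} → n ≡ m ℕ.+ suc k → suc k ≤ n
    suc≤ {k} {m} e = subst (suc k ≤_) (sym e) (ℕ.m≤n+m (suc k) m)

    <suc : ∀ {k m n} → n ≡ m ℕ.+ suc k → m < n
    <suc {k} {m} e = subst (m <_) (sym e) (ℕ.m<m+n m (s≤s z≤n))

    add[++,+-] : ∀ a b c d → suc d √5*≤ c → NonNeg√5 (+ (a ℕ.+ c)) (b ⊖ suc d)
    add[++,+-] a b c d h with b ⊖ suc d | ⊖-cases b (suc d)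
    ... | _ | ≥-case k _ = tt
    ... | _ | <-case k e = √5*≤-mono (suc≤ e) (ℕ.m≤n+m c a) h

    add[++,-+] : ∀ a b c d → suc c ≤√5* d → NonNeg√5 (a ⊖ suc c) (+ (b ℕ.+ d))
    add[++,-+] a b c d h with a ⊖ suc c | ⊖-cases a (suc c)
    ... | _ | ≥-case k _ = tt
    ... | _ | <-case k e = ≤√5*-mono (suc≤ e) (ℕ.m≤n+m d b) h

    add[+-,+-] : ∀ a b c d → suc b √5*≤ a → suc d √5*≤ c → suc (suc (b ℕ.+ d)) √5*≤ a ℕ.+ c
    add[+-,+-] a b c d h₁ h₂ =
      subst (_√5*≤ a ℕ.+ c) (cong suc (ℕ.+-suc b d)) (√5*≤-+ a (suc b) c (suc d) h₁ h₂)

    add[-+,-+] : ∀ a b c d → suc a ≤√5* b → suc c ≤√5* d → suc (suc (a ℕ.+ c)) ≤√5* b ℕ.+ d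
    add[-+,-+] a b c d h₁ h₂ =
      subst (_≤√5* b ℕ.+ d) (cong suc (ℕ.+-suc a c)) (≤√5*-+ (suc a) b (suc c) d h₁ h₂)

    add[+-,-+] : ∀ a b c d → suc b √5*≤ a → suc c ≤√5* d → NonNeg√5 (a ⊖ suc c) (d ⊖ suc b)
    add[+-,-+] a b c d h₁ h₂ with a ⊖ suc c | ⊖-cases a (suc c) | d ⊖ suc b | ⊖-cases d (suc b)
    ... | _ | ≥-case k e₁ | _ | ≥-case l e₂ = tt
    ... | _ | ≥-case k e₁ | _ | <-case l e₂ =
      √5*≤-cancelˡ (suc c) d k (suc l) h₂ (subst₂ _√5*≤_ e₂ e₁ h₁)
    ... | _ | <-case k e₁ | _ | ≥-case l e₂ =
      ≤√5*-cancelˡ a (suc b) (suc k) l h₁ (subst₂ _≤√5*_ e₁ e₂ h₂)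
    ... | _ | <-case k e₁ | _ | <-case l e₂ = ⊥-elim (ℕ.<⇒≱ c+1<a (ℕ.<⇒≤ (<suc e₁)))
      where
      c+1<a : suc c < a
      c+1<a = m*m<n*n⇒m<n (suc c) a
        (ℕ.≤-<-trans h₂ (ℕ.<-≤-trans (ℕ.*-monoʳ-< 5 (ℕ.*-mono-< d<b+1 d<b+1)) h₁))
        where d<b+1 = <suc e₂

  nonNeg√5-+ : ∀ {A B C D} → NonNeg√5 A B → NonNeg√5 C D → NonNeg√5 (A + C) (B + D)
  nonNeg√5-+ { + a }      { + b }      { + c }      { + d }      _  _  = tt
  nonNeg√5-+ { + a }      { + b }      { + c }      { -[1+ d ] } _  h  = add[++,+-] a b c d h
  nonNeg√5-+ { + a }      { + b }      { -[1+ c ] } { + d }      _  h  = add[++,-+] a b c d h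
  nonNeg√5-+ { + a }      { -[1+ b ] } { + c }      { + d }      h  _  =
    subst (λ s → NonNeg√5 (+ s) (d ⊖ suc b)) (ℕ.+-comm c a) (add[++,+-] c d a b h)
  nonNeg√5-+ { + a }      { -[1+ b ] } { + c }      { -[1+ d ] } h₁ h₂ = add[+-,+-] a b c d h₁ h₂
  nonNeg√5-+ { + a }      { -[1+ b ] } { -[1+ c ] } { + d }      h₁ h₂ = add[+-,-+] a b c d h₁ h₂
  nonNeg√5-+ { -[1+ a ] } { + b }      { + c }      { + d }      h  _  =
    subst (λ s → NonNeg√5 (c ⊖ suc a) (+ s)) (ℕ.+-comm d b) (add[++,-+] c d a b h)
  nonNeg√5-+ { -[1+ a ] } { + b }      { + c }      { -[1+ d ] } h₁ h₂ = add[+-,-+] c d a b h₂ h₁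
  nonNeg√5-+ { -[1+ a ] } { + b }      { -[1+ c ] } { + d }      h₁ h₂ = add[-+,-+] a b c d h₁ h₂
  nonNeg√5-+ { + a }      { + b }      { -[1+ c ] } { -[1+ d ] } _  ()
  nonNeg√5-+ { + a }      { -[1+ b ] } { -[1+ c ] } { -[1+ d ] } _  ()
  nonNeg√5-+ { -[1+ a ] } { + b }      { -[1+ c ] } { -[1+ d ] } _  ()
  nonNeg√5-+ { -[1+ a ] } { -[1+ b ] } ()                        _

  nonNeg√5-total : ∀ A B → NonNeg√5 A B ⊎ NonNeg√5 (- A) (- B)
  nonNeg√5-total (+ a)    (+ b)    = inj₁ tt
  nonNeg√5-total (+ a)    -[1+ b ] with suc b √5*≤? a
  ... | yes h = inj₁ h
  nonNeg√5-total (+ zero)    -[1+ b ] | no _ = inj₂ tt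
  nonNeg√5-total (+ (suc a)) -[1+ b ] | no h = inj₂ (ℕ.<⇒≤ (ℕ.≰⇒> h))
  nonNeg√5-total -[1+ a ] (+ b)    with suc a ≤√5*? b
  ... | yes h = inj₁ h
  nonNeg√5-total -[1+ a ] (+ zero)    | no _ = inj₂ tt
  nonNeg√5-total -[1+ a ] (+ (suc b)) | no h = inj₂ (ℕ.<⇒≤ (ℕ.≰⇒> h))
  nonNeg√5-total -[1+ a ] -[1+ b ] = inj₂ tt

  nonNeg√5? : ∀ A B → Dec (NonNeg√5 A B)
  nonNeg√5? (+ a)    (+ b)    = yes tt
  nonNeg√5? (+ a)    -[1+ b ] = suc b √5*≤? a
  nonNeg√5? -[1+ a ] (+ b)    = suc a ≤√5*? b
  nonNeg√5? -[1+ a ] -[1+ b ] = no λ ()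

  ¬nonNeg√5⇒nonNeg√5-neg : ∀ {A B} → ¬ NonNeg√5 A B → NonNeg√5 (- A) (- B)
  ¬nonNeg√5⇒nonNeg√5-neg {A} {B} h with nonNeg√5-total A B
  ... | inj₁ p = ⊥-elim (h p)
  ... | inj₂ p = p

  nonNeg√5-antisym : ∀ {A B} → NonNeg√5 A B → NonNeg√5 (- A) (- B) → A ≡ + 0 × B ≡ + 0
  nonNeg√5-antisym { + zero }    { + zero }    _ _ = refl , refl
  nonNeg√5-antisym { + (suc a) } { -[1+ b ] } h₁ h₂ =
    ⊥-elim (ℕ.0≢1+n (sym (√5-irrational (suc a) (suc b) (ℕ.≤-antisym h₂ h₁))))
  nonNeg√5-antisym { -[1+ a ] } { + (suc b) } h₁ h₂ =
    ⊥-elim (ℕ.0≢1+n (sym (√5-irrational (suc a) (suc b) (ℕ.≤-antisym h₁ h₂))))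
  nonNeg√5-antisym { + zero }    { + (suc b) } _ ()
  nonNeg√5-antisym { + (suc a) } { + zero }    _ ()
  nonNeg√5-antisym { + (suc a) } { + (suc b) } _ ()
  nonNeg√5-antisym { + zero }    { -[1+ b ] } ()
  nonNeg√5-antisym { -[1+ a ] } { + zero }    ()
  nonNeg√5-antisym { -[1+ a ] } { -[1+ b ] } ()

  nonNeg√5-pos-* : ∀ k m n → NonNeg√5 (+ k * + m) (+ n)
  nonNeg√5-pos-* k m n rewrite sym (ℤ.pos-* k m) = tt

  nonNeg√5-*ℕ : ∀ k {A B} → NonNeg√5 A B → NonNeg√5 (+ k * A) (+ k * B)
  nonNeg√5-*ℕ zero    h = tt
  nonNeg√5-*ℕ (suc k) {A} {B} h =
    subst₂ NonNeg√5 (unfold (+ k) A) (unfold (+ k) B) (nonNeg√5-+ h (nonNeg√5-*ℕ k h))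
    where
    unfold : ∀ K X → X + K * X ≡ (+ 1 + K) * X
    unfold = solve-∀

  private
    pos-*-cancel : ∀ k {X} → + suc k * X ≡ + 0 → X ≡ + 0
    pos-*-cancel k {X} e = ℤ.*-cancelˡ-≡ (+ suc k) X (+ 0) (trans e (sym (ℤ.*-zeroʳ (+ suc k))))

  nonNeg√5-cancel-*ℕ : ∀ k {A B} → NonNeg√5 (+ suc k * A) (+ suc k * B) → NonNeg√5 A B
  nonNeg√5-cancel-*ℕ k {A} {B} h with nonNeg√5-total A B
  ... | inj₁ p = p
  ... | inj₂ p with nonNeg√5-antisym h (subst₂ NonNeg√5 (negate A) (negate B) (nonNeg√5-*ℕ (suc k) p))
    where
    negate : ∀ X → + suc k * - X ≡ - (+ suc k * X)
    negate X = sym (ℤ.neg-distribʳ-* (+ suc k) X)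
  ... | kA≡0 , kB≡0 = subst₂ NonNeg√5 (sym (pos-*-cancel k kA≡0)) (sym (pos-*-cancel k kB≡0)) tt

  nonNeg√5-*√5 : ∀ {A B} → NonNeg√5 A B → NonNeg√5 (+ 5 * B) A
  nonNeg√5-*√5 { + a }    { + b }    h rewrite sym (ℤ.pos-* 5 b) = tt
  nonNeg√5-*√5 { + a }    { -[1+ b ] } h = subst (_≤ 5 ℕ.* (a ℕ.* a)) (five-square (suc b)) (ℕ.*-monoʳ-≤ 5 h)
    where
    five-square : ∀ x → 5 ℕ.* (5 ℕ.* (x ℕ.* x)) ≡ (5 ℕ.* x) ℕ.* (5 ℕ.* x)
    five-square = ℕ-Solver.solve-∀
  nonNeg√5-*√5 { -[1+ a ] } { + b }  h rewrite sym (ℤ.pos-* 5 b) =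
    subst (5 ℕ.* (suc a ℕ.* suc a) ≤_) (five-square b) (ℕ.*-monoʳ-≤ 5 h)
    where
    five-square : ∀ x → 5 ℕ.* (5 ℕ.* (x ℕ.* x)) ≡ (5 ℕ.* x) ℕ.* (5 ℕ.* x)
    five-square = ℕ-Solver.solve-∀
  nonNeg√5-*√5 { -[1+ a ] } { -[1+ b ] } ()

  nonNeg√5-*1+√5 : ∀ {A B} → NonNeg√5 A B → NonNeg√5 (A + + 5 * B) (A + B)
  nonNeg√5-*1+√5 {A} {B} h = subst (NonNeg√5 _) (ℤ.+-comm B A) (nonNeg√5-+ h (nonNeg√5-*√5 h))

module GoldenFloor where
  open import Data.Nat.Base using (_∸_)
  open import Data.Integer.Base using (ℤ; +_; -[1+_]; _⊖_; _+_; _-_; _*_; -_)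
  open import Data.Integer.Tactic.RingSolver using (solve-∀)
  open SquareComparison
  open ℤ[√5]-Order

  infix 4 _≤Φ*_ _≤Φ*?_

  -- b ≤Φ* n  ⇔  b ≤ nΦ  ⇔  2b ≤ n + n√5
  record _≤Φ*_ (b n : ℕ) : Set where
    constructor mk≤Φ*
    field nonNeg : NonNeg√5 (+ n - + 2 * + b) (+ n)
  open _≤Φ*_

  _≤Φ*?_ : ∀ b n → Dec (b ≤Φ* n)
  b ≤Φ*? n = map′ mk≤Φ* nonNeg (nonNeg√5? _ _)

  private
    pos-+-≤Φ* : ∀ b d n → b ℕ.+ d ≤Φ* n → NonNeg√5 (+ n - + 2 * (+ b + + d)) (+ n)
    pos-+-≤Φ* b d n h = subst (λ z → NonNeg√5 (+ n - + 2 * z) (+ n)) (ℤ.pos-+ b d) (nonNeg h)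

  ≤Φ*-antitoneˡ : ∀ {b b′ n} → b ≤ b′ → b′ ≤Φ* n → b ≤Φ* n
  ≤Φ*-antitoneˡ {b} {n = n} b≤b′ h with ℕ.m≤n⇒∃[o]m+o≡n b≤b′
  ... | d , refl = mk≤Φ* (subst₂ NonNeg√5 (drop (+ n) (+ b) (+ d)) (ℤ.+-identityʳ (+ n))
    (nonNeg√5-+ (pos-+-≤Φ* b d n h) (nonNeg√5-pos-* 2 d 0)))
    where
    drop : ∀ N B D → N - + 2 * (B + D) + + 2 * D ≡ N - + 2 * B
    drop = solve-∀

  ≤Φ*-monoʳ : ∀ {b n n′} → n ≤ n′ → b ≤Φ* n → b ≤Φ* n′
  ≤Φ*-monoʳ {b} {n} n≤n′ h with ℕ.m≤n⇒∃[o]m+o≡n n≤n′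
  ... | e , refl = mk≤Φ* (subst (λ z → NonNeg√5 (z - + 2 * + b) z) (sym (ℤ.pos-+ n e))
    (subst (λ z → NonNeg√5 z (+ n + + e)) (raise (+ n) (+ b) (+ e))
      (nonNeg√5-+ {C = + e} {D = + e} (nonNeg h) tt)))
    where
    raise : ∀ N B E → N - + 2 * B + E ≡ N + E - + 2 * B
    raise = solve-∀

  -- Φ > 1, as √5 - 1 ≥ 0
  ≤Φ*-suc : ∀ {b n} → b ≤Φ* n → suc b ≤Φ* suc n
  ≤Φ*-suc {b} {n} h = mk≤Φ* (subst₂ NonNeg√5 (step (+ n) (+ b)) (ℤ.+-comm (+ n) (+ 1))
    (nonNeg√5-+ {C = - + 1} {D = + 1} (nonNeg h) (s≤s z≤n)))
    where
    step : ∀ N B → N - + 2 * B + - + 1 ≡ + 1 + N - + 2 * (+ 1 + B)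
    step = solve-∀

  -- Φ < 2, as 3 - √5 ≥ 0
  ≤Φ*-suc⁻ : ∀ {b n} → suc (suc b) ≤Φ* suc n → b ≤Φ* n
  ≤Φ*-suc⁻ {b} {n} h = mk≤Φ* (subst₂ NonNeg√5 (step (+ n) (+ b)) (unstep (+ n))
    (nonNeg√5-+ {C = + 3} {D = - + 1} (nonNeg h) (s≤s (s≤s (s≤s (s≤s (s≤s z≤n)))))))
    where
    step : ∀ N B → + 1 + N - + 2 * (+ 2 + B) + + 3 ≡ N - + 2 * B
    step = solve-∀
    unstep : ∀ N → + 1 + N + - + 1 ≡ N
    unstep = solve-∀

  ≤Φ*-refl : ∀ n → n ≤Φ* n
  ≤Φ*-refl zero    = mk≤Φ* tt
  ≤Φ*-refl (suc n) = ≤Φ*-suc (≤Φ*-refl n)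

  ≤Φ*-cancel-* : ∀ t {b n} → suc t ℕ.* b ≤Φ* suc t ℕ.* n → b ≤Φ* n
  ≤Φ*-cancel-* t {b} {n} h = mk≤Φ* (nonNeg√5-cancel-*ℕ t
    (subst (λ z → NonNeg√5 z _) (factor (+ suc t) (+ n) (+ b))
      (subst₂ (λ u v → NonNeg√5 (u - + 2 * v) u) (ℤ.pos-* (suc t) n) (ℤ.pos-* (suc t) b) (nonNeg h))))
    where
    factor : ∀ T N B → T * N - + 2 * (T * B) ≡ T * (N - + 2 * B)
    factor = solve-∀

  -- By Φ² = Φ + 1, k + m ≤ kΦ means mΦ ≤ k: the complement of k ≤ mΦ except for k = mΦ,
  -- which the irrationality of Φ excludes unless k = m = 0.
  ≤Φ*-reciprocal : ∀ k m → ¬ (k ℕ.+ m ≤Φ* k) → k ≤Φ* m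
  ≤Φ*-reciprocal k m h = mk≤Φ* (nonNeg√5-cancel-*ℕ 1
    (subst₂ NonNeg√5 (e₁ (+ k) (+ m)) (e₂ (+ k) (+ m))
      (nonNeg√5-*1+√5 (¬nonNeg√5⇒nonNeg√5-neg (h ∘ mk≤Φ* ∘ cast)))))
    where
    cast = subst (λ z → NonNeg√5 (+ k - + 2 * z) (+ k)) (sym (ℤ.pos-+ k m))
    e₁ : ∀ K M → - (K - + 2 * (K + M)) + + 5 * - K ≡ + 2 * (M - + 2 * K)
    e₁ = solve-∀
    e₂ : ∀ K M → - (K - + 2 * (K + M)) + - K ≡ + 2 * M
    e₂ = solve-∀

  ≤Φ*-reciprocal⁻ : ∀ {k m} → k ≤Φ* m → k ℕ.+ m ≤Φ* k → m ≡ 0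
  ≤Φ*-reciprocal⁻ {k} {m} h₁ h₂
    with nonNeg√5-antisym (nonNeg√5-*ℕ 2 (nonNeg h₁))
           (subst₂ NonNeg√5 (e₁ (+ k) (+ m)) (e₂ (+ k) (+ m)) (nonNeg√5-*1+√5 (pos-+-≤Φ* k m k h₂)))
    where
    e₁ : ∀ K M → K - + 2 * (K + M) + + 5 * K ≡ - (+ 2 * (M - + 2 * K))
    e₁ = solve-∀
    e₂ : ∀ K M → K - + 2 * (K + M) + K ≡ - (+ 2 * M)
    e₂ = solve-∀
  ... | _ , 2m≡0 with ℕ.m*n≡0⇒m≡0∨n≡0 2 (ℤ.+-injective (trans (ℤ.pos-* 2 m) 2m≡0))
  ... | inj₂ m≡0 = m≡0

  ≤Φ*-reciprocal′ : ∀ k m → ¬ k ≤Φ* m → k ℕ.+ m ≤Φ* k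
  ≤Φ*-reciprocal′ k m k≰mΦ = decidable-stable (k ℕ.+ m ≤Φ*? k) (k≰mΦ ∘ ≤Φ*-reciprocal k m)

  record FloorΦ (n a : ℕ) : Set where
    constructor mkFloorΦ
    field
      lower : a ≤Φ* n
      upper : ¬ suc a ≤Φ* n
  open FloorΦ public

  -- ⌊(n+1)Φ⌋ is ⌊nΦ⌋ + 1 or ⌊nΦ⌋ + 2, since 1 < Φ < 2
  floorΦ-exists : ∀ n → Σ ℕ (FloorΦ n)
  floorΦ-exists zero = 0 , mkFloorΦ (mk≤Φ* tt) λ { (mk≤Φ* ()) }
  floorΦ-exists (suc n) with floorΦ-exists n
  ... | a , F with suc (suc a) ≤Φ*? suc n
  ... | yes a+2≤ = suc (suc a) , mkFloorΦ a+2≤ (upper F ∘ ≤Φ*-suc⁻)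
  ... | no  a+2≰ = suc a , mkFloorΦ (≤Φ*-suc (lower F)) a+2≰

  ⌊_Φ⌋ : ℕ → ℕ
  ⌊ n Φ⌋ = proj₁ (floorΦ-exists n)

  floorΦ-⌊Φ⌋ : ∀ n → FloorΦ n ⌊ n Φ⌋
  floorΦ-⌊Φ⌋ n = proj₂ (floorΦ-exists n)

  floorΦ-maximal : ∀ {n a b} → FloorΦ n a → b ≤Φ* n → b ≤ a
  floorΦ-maximal {a = a} {b} F b≤nΦ with b ≤? a
  ... | yes b≤a = b≤a
  ... | no  b≰a = ⊥-elim (upper F (≤Φ*-antitoneˡ (ℕ.≰⇒> b≰a) b≤nΦ))

  floorΦ-unique : ∀ {n a c} → FloorΦ n a → FloorΦ n c → a ≡ c
  floorΦ-unique F G = ℕ.≤-antisym (floorΦ-maximal G (lower F)) (floorΦ-maximal F (lower G))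

  floorΦ-strictMono : ∀ {n m a c} → n < m → FloorΦ n a → FloorΦ m c → a < c
  floorΦ-strictMono n<m F G = floorΦ-maximal G (≤Φ*-monoʳ n<m (≤Φ*-suc (lower F)))

  floorΦ-injective : ∀ {n m a} → FloorΦ n a → FloorΦ m a → n ≡ m
  floorΦ-injective {n} {m} F G with ℕ.<-cmp n m
  ... | tri< n<m _ _ = ⊥-elim (ℕ.<-irrefl refl (floorΦ-strictMono n<m F G))
  ... | tri≈ _ n≡m _ = n≡m
  ... | tri> _ _ m<n = ⊥-elim (ℕ.<-irrefl refl (floorΦ-strictMono m<n G F))

  n≤floorΦ : ∀ {n a} → FloorΦ n a → n ≤ a
  n≤floorΦ {n} F = floorΦ-maximal F (≤Φ*-refl n)

  floorΦ-zero : ∀ {a} → FloorΦ 0 a → a ≡ 0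
  floorΦ-zero F = floorΦ-unique F (floorΦ-⌊Φ⌋ 0)

  floorΦ-bracket : ∀ x → Σ ℕ λ k → ⌊ k Φ⌋ ≤ x × x < ⌊ suc k Φ⌋
  floorΦ-bracket zero = 0 , z≤n , floorΦ-strictMono (s≤s z≤n) (floorΦ-⌊Φ⌋ 0) (floorΦ-⌊Φ⌋ 1)
  floorΦ-bracket (suc x) with floorΦ-bracket x
  ... | k , c≤x , x<c′ with suc x ℕ.<? ⌊ suc k Φ⌋
  ... | yes x+1<c′ = k , ℕ.m≤n⇒m≤1+n c≤x , x+1<c′
  ... | no  x+1≮c′ = suc k , ℕ.≤-reflexive c′≡x+1 ,
    subst (_< ⌊ suc (suc k) Φ⌋) c′≡x+1 (floorΦ-strictMono (ℕ.n<1+n (suc k)) (floorΦ-⌊Φ⌋ _) (floorΦ-⌊Φ⌋ _))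
    where
    c′≡x+1 : ⌊ suc k Φ⌋ ≡ suc x
    c′≡x+1 = ℕ.≤-antisym (ℕ.≮⇒≥ x+1≮c′) x<c′

  -- Beatty's theorem for Φ and Φ² = Φ + 1
  beatty-cover : ∀ x → (Σ ℕ λ k → FloorΦ k x) ⊎ (Σ ℕ λ n → Σ ℕ λ a → FloorΦ n a × 0 < n × x ≡ a ℕ.+ n)
  beatty-cover x with floorΦ-bracket x
  ... | k , c≤x , x<c′ with ⌊ k Φ⌋ ℕ.≟ x
  ... | yes c≡x = inj₁ (k , subst (FloorΦ k) c≡x (floorΦ-⌊Φ⌋ k))
  ... | no  c≢x = inj₂ (x ∸ k , k , mkFloorΦ k≤mΦ k+1≰mΦ , ℕ.m<n⇒0<n∸m k<x , x≡k+m)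
    where
    c<x = ℕ.≤∧≢⇒< c≤x c≢x
    k<x = ℕ.≤-<-trans (n≤floorΦ (floorΦ-⌊Φ⌋ k)) c<x
    x≡k+m : x ≡ k ℕ.+ (x ∸ k)
    x≡k+m = sym (ℕ.m+[n∸m]≡n (ℕ.<⇒≤ k<x))
    k≤mΦ : k ≤Φ* x ∸ k
    k≤mΦ = ≤Φ*-reciprocal k (x ∸ k)
      (upper (floorΦ-⌊Φ⌋ k) ∘ ≤Φ*-antitoneˡ c<x ∘ subst (_≤Φ* k) (sym x≡k+m))
    k+1≰mΦ : ¬ suc k ≤Φ* x ∸ k
    k+1≰mΦ k+1≤mΦ = ℕ.<⇒≢ (ℕ.m<n⇒0<n∸m k<x) (sym (≤Φ*-reciprocal⁻ k+1≤mΦ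
      (≤Φ*-antitoneˡ (subst (_≤ ⌊ suc k Φ⌋) (cong suc x≡k+m) x<c′) (lower (floorΦ-⌊Φ⌋ (suc k))))))

  beatty-disjoint : ∀ {m c n} → FloorΦ m c → FloorΦ n (c ℕ.+ m) → m ≡ 0
  beatty-disjoint {m} {c} {n} G F with n ≤? c
  ... | yes n≤c = ≤Φ*-reciprocal⁻ (lower G) (≤Φ*-monoʳ n≤c (lower F))
  ... | no  n≰c = ⊥-elim (upper F (≤Φ*-monoʳ (ℕ.≰⇒> n≰c) (≤Φ*-reciprocal′ (suc c) m (upper G))))

  ≤Φ*⇔≤√5* : ∀ b n → b ≤Φ* n ⇔ 2 ℕ.* b ∸ n ≤√5* n
  ≤Φ*⇔≤√5* b n = mk⇔ (Equivalence.to equiv ∘ cast ∘ nonNeg) (mk≤Φ* ∘ uncast ∘ Equivalence.from equiv)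
    where
    as-⊖ : + n - + 2 * + b ≡ n ⊖ 2 ℕ.* b
    as-⊖ = trans (cong (_-_ (+ n)) (sym (ℤ.pos-* 2 b))) (ℤ.[+m]-[+n]≡m⊖n n (2 ℕ.* b))
    cast = subst (λ z → NonNeg√5 z (+ n)) as-⊖
    uncast = subst (λ z → NonNeg√5 z (+ n)) (sym as-⊖)
    cases : ∀ i → ⊖-Cases n (2 ℕ.* b) i → NonNeg√5 i (+ n) ⇔ 2 ℕ.* b ∸ n ≤√5* n
    cases _ (≥-case k e) = mk⇔ (λ _ → subst (_≤√5* n) (sym (ℕ.m≤n⇒m∸n≡0 2b≤n)) z≤n) (λ _ → tt)
      where 2b≤n = subst (2 ℕ.* b ≤_) (sym e) (ℕ.m≤m+n (2 ℕ.* b) k)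
    cases _ (<-case k e) =
      subst (λ z → suc k ≤√5* n ⇔ z ≤√5* n) (sym (trans (cong (_∸ n) e) (ℕ.m+n∸m≡n n (suc k)))) ⇔-refl
    equiv = cases (n ⊖ 2 ℕ.* b) (⊖-cases n (2 ℕ.* b))

  floorΦ⇔floorNPhi : ∀ n a → FloorΦ n a ⇔ FloorNPhi n a
  floorΦ⇔floorNPhi n a = mk⇔
    (λ F → Equivalence.to lower⇔ (lower F) , ℕ.≰⇒> (upper F ∘ Equivalence.from upper⇔))
    (λ (l , u) → mkFloorΦ (Equivalence.from lower⇔ l) (ℕ.<⇒≱ u ∘ Equivalence.to upper⇔))
    where
    lower⇔ : a ≤Φ* n ⇔ 2 ℕ.* a ∸ 1 ℕ.* n ≤√5* n
    lower⇔ = subst (λ z → a ≤Φ* n ⇔ 2 ℕ.* a ∸ z ≤√5* n) (sym (ℕ.*-identityˡ n)) (≤Φ*⇔≤√5* a n)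
    upper⇔ : suc a ≤Φ* n ⇔ 2 ℕ.* a ℕ.+ 2 ∸ 1 ℕ.* n ≤√5* n
    upper⇔ = subst (λ z → suc a ≤Φ* n ⇔ z ≤√5* n)
      (cong₂ _∸_ (trans (ℕ.*-suc 2 a) (ℕ.+-comm 2 (2 ℕ.* a))) (sym (ℕ.*-identityˡ n)))
      (≤Φ*⇔≤√5* (suc a) n)

  ltTimesPhi⇒≤Φ* : ∀ {q p} → LtTimesPhi q p → q ≤Φ* p
  ltTimesPhi⇒≤Φ* {q} {p} q<pΦ = Equivalence.from (≤Φ*⇔≤√5* q p) (ℕ.<⇒≤ q<pΦ)

  floorΦ-difference : ∀ {n m a c d e} → FloorΦ n a → FloorΦ m c →
                      a ≡ c ℕ.+ suc d → n ≡ m ℕ.+ e → d ≤Φ* e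
  floorΦ-difference {m = m} {c = c} {d} {e} F G refl refl =
    mk≤Φ* (subst₂ NonNeg√5 (e₁ (+ m) (+ c) (+ d) (+ e)) (e₂ (+ m) (+ e))
      (nonNeg√5-+ (cast (nonNeg (lower F))) (¬nonNeg√5⇒nonNeg√5-neg (upper G ∘ mk≤Φ*))))
    where
    cast = subst₂ (λ u v → NonNeg√5 (u - + 2 * v) u) (ℤ.pos-+ m e) (ℤ.pos-+ c (suc d))
    e₁ : ∀ M C D E → M + E - + 2 * (C + (+ 1 + D)) + - (M - + 2 * (+ 1 + C)) ≡ E - + 2 * D
    e₁ = solve-∀
    e₂ : ∀ M E → M + E + - M ≡ E
    e₂ = solve-∀

open SquareComparison using (_≤√5*_)
open GoldenFloor
open import Data.Nat.Base using (_+_; _*_; _∸_)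
open ℕ-Solver using (solve-∀)

Reaches : Rule → (ℕ → ℕ → Set) → ℕ → ℕ → Set
Reaches R S x y = Σ ℕ λ x′ → Σ ℕ λ y′ → Option R x y x′ y′ × S x′ y′

Option-map : ∀ {R R′ x y x′ y′} → (∀ {m n} → R m n → R′ m n) → Option R x y x′ y′ → Option R′ x y x′ y′
Option-map f (m , n , move , ex , ey) = m , n , f move , ex , ey

IsN⇒¬IsP : ∀ {R x y} → IsN R x y → ¬ IsP R x y
IsN⇒¬IsP (isN x′ y′ o P′) (isP noP) = IsN⇒¬IsP (noP x′ y′ o) P′

option-decreasing : ∀ {R x y x′ y′} → (∀ {m n} → R m n → 0 < m + n) →
                    Option R x y x′ y′ → x′ + y′ < x + y
option-decreasing {x′ = x′} {y′} nonzero (m , n , move , refl , refl) =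
  subst (x′ + y′ <_) (regroup x′ y′ m n) (ℕ.m<m+n (x′ + y′) (nonzero move))
  where
  regroup : ∀ x′ y′ m n → x′ + y′ + (m + n) ≡ x′ + m + (y′ + n)
  regroup = solve-∀

record IsKernel (R : Rule) (S : ℕ → ℕ → Set) : Set where
  field
    independent : ∀ {x y x′ y′} → S x y → S x′ y′ → ¬ Option R x y x′ y′
    absorbing   : ∀ x y → S x y ⊎ Reaches R S x y

kernel⇒IsP⇔ : ∀ {R S} → (∀ {m n} → R m n → 0 < m + n) → IsKernel R S → ∀ x y → IsP R x y ⇔ S x y
kernel⇒IsP⇔ {R} {S} nonzero K x y = mk⇔ (proj₁ (bounded (suc (x + y)) x y ℕ.≤-refl))
                                         (proj₂ (bounded (suc (x + y)) x y ℕ.≤-refl))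
  where
  open IsKernel K
  bounded : ∀ k x y → x + y < k → (IsP R x y → S x y) × (S x y → IsP R x y)
  bounded (suc k) x y (s≤s x+y≤k) = P⇒S , S⇒P
    where
    below : ∀ {x′ y′} → Option R x y x′ y′ → x′ + y′ < k
    below o = ℕ.<-≤-trans (option-decreasing nonzero o) x+y≤k

    P⇒S : IsP R x y → S x y
    P⇒S (isP noP) with absorbing x y
    ... | inj₁ s = s
    ... | inj₂ (x′ , y′ , o , s′) = ⊥-elim (IsN⇒¬IsP (noP x′ y′ o) (proj₂ (bounded k x′ y′ (below o)) s′))

    S⇒P : S x y → IsP R x y
    S⇒P s = isP option-IsN
      where
      option-IsN : ∀ x′ y′ → Option R x y x′ y′ → IsN R x′ y′
      option-IsN x′ y′ o with absorbing x′ y′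
      ... | inj₁ s′ = ⊥-elim (independent s s′ o)
      ... | inj₂ (x″ , y″ , o′ , s″) =
        isN x″ y″ o′ (proj₂ (bounded k x″ y″ (ℕ.<-trans (option-decreasing nonzero o′) (below o))) s″)

private
  -- 2(a + n) - 3n = 2a - n, so ⌊nΦ²⌋ = ⌊nΦ⌋ + n
  shift-lower : ∀ a n → 2 * (a + n) ∸ 3 * n ≡ 2 * a ∸ 1 * n
  shift-lower a n = trans (cong₂ _∸_ (e₁ a n) (e₂ n)) (ℕ.[m+n]∸[m+o]≡n∸o (2 * n) (2 * a) (1 * n))
    where
    e₁ : ∀ a n → 2 * (a + n) ≡ 2 * n + 2 * a
    e₁ = solve-∀
    e₂ : ∀ n → 3 * n ≡ 2 * n + 1 * n
    e₂ = solve-∀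

  shift-upper : ∀ a n → 2 * (a + n) + 2 ∸ 3 * n ≡ 2 * a + 2 ∸ 1 * n
  shift-upper a n = trans (cong₂ _∸_ (e₁ a n) (e₂ n)) (ℕ.[m+n]∸[m+o]≡n∸o (2 * n) (2 * a + 2) (1 * n))
    where
    e₁ : ∀ a n → 2 * (a + n) + 2 ≡ 2 * n + (2 * a + 2)
    e₁ = solve-∀
    e₂ : ∀ n → 3 * n ≡ 2 * n + 1 * n
    e₂ = solve-∀

floorNPhi⇒floorNPhi2 : ∀ {n a} → FloorNPhi n a → FloorNPhi2 n (a + n)
floorNPhi⇒floorNPhi2 {n} {a} (lower , upper) =
  subst (_≤√5* n) (sym (shift-lower a n)) lower ,
  subst (λ z → 5 * (n * n) < z * z) (sym (shift-upper a n)) upper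

floorNPhi2⇒floorNPhi : ∀ {n b} → FloorNPhi2 n b → Σ ℕ λ a → b ≡ a + n × FloorNPhi n a
floorNPhi2⇒floorNPhi {n} {b} (lower , upper) with n ≤? b
... | yes n≤b = b ∸ n , b≡a+n ,
  subst (_≤√5* n) (shift-lower (b ∸ n) n) (subst (λ z → 2 * z ∸ 3 * n ≤√5* n) b≡a+n lower) ,
  subst (λ z → 5 * (n * n) < z * z) (shift-upper (b ∸ n) n)
    (subst (λ z → 5 * (n * n) < (2 * z + 2 ∸ 3 * n) * (2 * z + 2 ∸ 3 * n)) b≡a+n upper)
  where
  b≡a+n = sym (ℕ.m∸n+n≡m n≤b)
... | no  n≰b = ⊥-elim (ℕ.<⇒≱ upper (subst (λ z → z * z ≤ 5 * (n * n)) (sym (ℕ.m≤n⇒m∸n≡0 2b+2≤3n)) z≤n))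
  where
  2b+2≤3n : 2 * b + 2 ≤ 3 * n
  2b+2≤3n = ℕ.≤-trans (subst (_≤ 2 * n) (trans (ℕ.*-suc 2 b) (ℕ.+-comm 2 (2 * b))) (ℕ.*-monoʳ-≤ 2 (ℕ.≰⇒> n≰b)))
                      (ℕ.*-monoˡ-≤ n {2} {3} (s≤s (s≤s z≤n)))

data Wythoff : ℕ → ℕ → Set where
  ascending  : ∀ {n a} → FloorΦ n a → Wythoff a (a + n)
  descending : ∀ {n a} → FloorΦ n a → Wythoff (a + n) a

wythoff-swap : ∀ {x y} → Wythoff x y → Wythoff y x
wythoff-swap (ascending F)  = descending F
wythoff-swap (descending F) = ascending F

private
  wythoff⇒wythoffPairs : ∀ {x y} → Wythoff x y → WythoffPairs x y
  wythoff⇒wythoffPairs (ascending {n} {a} F) =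
    n , a , a + n , F′ , floorNPhi⇒floorNPhi2 {n} {a} F′ , inj₁ (refl , refl)
    where F′ = Equivalence.to (floorΦ⇔floorNPhi n a) F
  wythoff⇒wythoffPairs (descending {n} {a} F) =
    n , a , a + n , F′ , floorNPhi⇒floorNPhi2 {n} {a} F′ , inj₂ (refl , refl)
    where F′ = Equivalence.to (floorΦ⇔floorNPhi n a) F

  wythoffPairs⇒wythoff : ∀ {x y} → WythoffPairs x y → Wythoff x y
  wythoffPairs⇒wythoff (n , a , b , Fa , Fb , position) with floorNPhi2⇒floorNPhi {n} {b} Fb
  ... | a′ , refl , Fa′ with floorΦ-unique (Equivalence.from (floorΦ⇔floorNPhi n a) Fa)
                                          (Equivalence.from (floorΦ⇔floorNPhi n a′) Fa′)
  ... | refl with position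
  ... | inj₁ (refl , refl) = ascending  (Equivalence.from (floorΦ⇔floorNPhi n a) Fa)
  ... | inj₂ (refl , refl) = descending (Equivalence.from (floorΦ⇔floorNPhi n a) Fa)

wythoff⇔wythoffPairs : ∀ x y → Wythoff x y ⇔ WythoffPairs x y
wythoff⇔wythoffPairs x y = mk⇔ wythoff⇒wythoffPairs wythoffPairs⇒wythoff

upperWythoff-injective : ∀ {n m a c} → FloorΦ n a → FloorΦ m c → a + n ≡ c + m → n ≡ m
upperWythoff-injective {n} {m} F G e with ℕ.<-cmp n m
... | tri< n<m _ _ = ⊥-elim (ℕ.<-irrefl e (ℕ.+-mono-< (floorΦ-strictMono n<m F G) n<m))
... | tri≈ _ n≡m _ = n≡m
... | tri> _ _ m<n = ⊥-elim (ℕ.<-irrefl (sym e) (ℕ.+-mono-< (floorΦ-strictMono m<n G F) m<n))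

wythoff-functional : ∀ {x y x′ y′} → Wythoff x y → Wythoff x′ y′ → x ≡ x′ → y ≡ y′
wythoff-functional (ascending F) (ascending G) refl = cong (_ +_) (floorΦ-injective F G)
wythoff-functional (ascending F) (descending G) refl with beatty-disjoint G F
... | refl with floorΦ-zero G
... | refl with ℕ.n≤0⇒n≡0 (n≤floorΦ F)
... | refl = refl
wythoff-functional (descending F) (ascending G) refl with beatty-disjoint F G
... | refl with floorΦ-zero F
... | refl with ℕ.n≤0⇒n≡0 (n≤floorΦ G)
... | refl = refl
wythoff-functional (descending {n} F) (descending G) e with upperWythoff-injective F G e
... | refl = ℕ.+-cancelʳ-≡ n _ _ e

wythoff-no-vertical : ∀ {x y x′ y′ t} → Wythoff x y → Wythoff x′ y′ → x ≡ x′ → y ≢ y′ + suc t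
wythoff-no-vertical W W′ x≡x′ y≡y′+t+1 = ℕ.m+1+n≢m _ (trans (sym y≡y′+t+1) (wythoff-functional W W′ x≡x′))

private
  no-diagonal-same-side : ∀ {n m a c t} → FloorΦ n a → FloorΦ m c →
                          a ≡ c + suc t → a + n ≡ c + m + suc t → ⊥
  no-diagonal-same-side {n} {m} {c = c} {t} F G refl e =
    ℕ.m+1+n≢m c (floorΦ-unique F (subst (λ k → FloorΦ k c) (sym n≡m) G))
    where
    shuffle : ∀ c m s → c + m + s ≡ c + s + m
    shuffle = solve-∀
    n≡m : n ≡ m
    n≡m = ℕ.+-cancelˡ-≡ (c + suc t) n m (trans e (shuffle c m (suc t)))

  no-diagonal-opposite-sides : ∀ {n m a c t} → FloorΦ n a → FloorΦ m c →
                               a ≡ c + m + suc t → a + n ≡ c + suc t → ⊥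
  no-diagonal-opposite-sides {n} {m} {c = c} {t} F G refl e =
    ℕ.0≢1+n (sym (trans (sym (ℕ.+-suc (c + m) t)) (floorΦ-zero (subst (λ k → FloorΦ k _) n≡0 F))))
    where
    shuffle : ∀ c m s n → c + m + s + n ≡ c + s + (m + n)
    shuffle = solve-∀
    n≡0 : n ≡ 0
    n≡0 = ℕ.m+n≡0⇒n≡0 m (ℕ.+-cancelˡ-≡ (c + suc t) (m + n) 0
      (trans (sym (shuffle c m (suc t) n)) (trans e (sym (ℕ.+-identityʳ (c + suc t))))))

wythoff-no-diagonal : ∀ {x y x′ y′ t} → Wythoff x y → Wythoff x′ y′ →
                      x ≡ x′ + suc t → y ≡ y′ + suc t → ⊥
wythoff-no-diagonal (ascending F)  (ascending G)  e₁ e₂ = no-diagonal-same-side F G e₁ e₂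
wythoff-no-diagonal (ascending F)  (descending G) e₁ e₂ = no-diagonal-opposite-sides F G e₁ e₂
wythoff-no-diagonal (descending F) (ascending G)  e₁ e₂ = no-diagonal-opposite-sides F G e₂ e₁
wythoff-no-diagonal (descending F) (descending G) e₁ e₂ = no-diagonal-same-side F G e₂ e₁

private
  vertical : ∀ {x y′ s} → 0 < s → Option WythoffMove x (y′ + s) x y′
  vertical {x} {s = s} 0<s = 0 , s , (s , 0<s , inj₁ (refl , refl)) , sym (ℕ.+-identityʳ x) , refl

  diagonal : ∀ {x′ y′ s} → 0 < s → Option WythoffMove (x′ + s) (y′ + s) x′ y′
  diagonal {s = s} 0<s = s , s , (s , 0<s , inj₂ (inj₂ (refl , refl))) , refl , refl

  reaches-swap : ∀ {x y} → Reaches WythoffMove Wythoff x y → Reaches WythoffMove Wythoff y x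
  reaches-swap (x′ , y′ , (m , n , (t , 0<t , move) , ex , ey) , W) =
    y′ , x′ , (n , m , (t , 0<t , mirror move) , ey , ex) , wythoff-swap W
    where
    mirror : ∀ {m n t} → (m ≡ 0 × n ≡ t) ⊎ (m ≡ t × n ≡ 0) ⊎ (m ≡ t × n ≡ t) →
                         (n ≡ 0 × m ≡ t) ⊎ (n ≡ t × m ≡ 0) ⊎ (n ≡ t × m ≡ t)
    mirror (inj₁ (m≡0 , n≡t))        = inj₂ (inj₁ (n≡t , m≡0))
    mirror (inj₂ (inj₁ (m≡t , n≡0))) = inj₁ (n≡0 , m≡t)
    mirror (inj₂ (inj₂ (m≡t , n≡t))) = inj₂ (inj₂ (n≡t , m≡t))

  -- (c, c + d) with c = ⌊kΦ⌋: a vertical move reaches (c, c + k) if d > k, and if d < k a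
  -- diagonal move reaches (⌊dΦ⌋, ⌊dΦ⌋ + d).
  absorbing-from-lower : ∀ {k c} → FloorΦ k c → ∀ d →
                         Wythoff c (c + d) ⊎ Reaches WythoffMove Wythoff c (c + d)
  absorbing-from-lower {k} {c} F d with ℕ.<-cmp d k
  ... | tri≈ _ refl _ = inj₁ (ascending F)
  ... | tri> _ _ k<d = inj₂ (c , c + k ,
    subst (λ y → Option WythoffMove c y c (c + k)) c+k+[d∸k]≡c+d (vertical (ℕ.m<n⇒0<n∸m k<d)) , ascending F)
    where
    c+k+[d∸k]≡c+d = trans (ℕ.+-assoc c k (d ∸ k)) (cong (c +_) (ℕ.m+[n∸m]≡n (ℕ.<⇒≤ k<d)))
  ... | tri< d<k _ _ = inj₂ (⌊ d Φ⌋ , ⌊ d Φ⌋ + d ,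
    subst₂ (λ x y → Option WythoffMove x y e (e + d)) e+s≡c e+d+s≡c+d (diagonal (ℕ.m<n⇒0<n∸m e<c)) ,
    ascending (floorΦ-⌊Φ⌋ d))
    where
    e = ⌊ d Φ⌋
    e<c = floorΦ-strictMono d<k (floorΦ-⌊Φ⌋ d) F
    e+s≡c = ℕ.m+[n∸m]≡n (ℕ.<⇒≤ e<c)
    shuffle : ∀ e d s → e + d + s ≡ e + s + d
    shuffle = solve-∀
    e+d+s≡c+d = trans (shuffle e d (c ∸ e)) (cong (_+ d) e+s≡c)

  absorbing-≤ : ∀ x d → Wythoff x (x + d) ⊎ Reaches WythoffMove Wythoff x (x + d)
  absorbing-≤ x d with beatty-cover x
  ... | inj₁ (k , F) = absorbing-from-lower F d
  ... | inj₂ (n , a , F , 0<n , refl) = inj₂ (a + n , a ,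
    subst (λ y → Option WythoffMove (a + n) y (a + n) a) (sym (ℕ.+-assoc a n d))
      (vertical (ℕ.≤-trans 0<n (ℕ.m≤m+n n d))) , descending F)

wythoff-absorbing : ∀ x y → Wythoff x y ⊎ Reaches WythoffMove Wythoff x y
wythoff-absorbing x y with x ≤? y
... | yes x≤y = subst (λ y → Wythoff x y ⊎ Reaches WythoffMove Wythoff x y) (ℕ.m+[n∸m]≡n x≤y)
                      (absorbing-≤ x (y ∸ x))
... | no  x≰y = Sum.map wythoff-swap reaches-swap
  (subst (λ x → Wythoff y x ⊎ Reaches WythoffMove Wythoff y x) (ℕ.m+[n∸m]≡n y≤x) (absorbing-≤ y (x ∸ y)))
  where y≤x = ℕ.<⇒≤ (ℕ.≰⇒> x≰y)

module GDWN (p′ j : ℕ) (p<q : suc p′ < suc p′ + j) (q≤pΦ : suc p′ + j ≤Φ* suc p′)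
            (not-splitting : ¬ SplittingPair (suc p′) (suc p′ + j)) where
  open ℕ.≤-Reasoning

  p q : ℕ
  p = suc p′
  q = p + j

  -- Φ² = Φ + 1 turns q < pΦ into jΦ < p
  p≰jΦ : ¬ p ≤Φ* j
  p≰jΦ p≤jΦ = ℕ.<-irrefl (sym (ℕ.+-identityʳ p)) (subst (λ k → p < p + k) (≤Φ*-reciprocal⁻ p≤jΦ q≤pΦ) p<q)

  private
    T*p<T*q : ∀ t → suc t * p < suc t * q
    T*p<T*q t = ℕ.*-monoʳ-< (suc t) p<q

    -- The two positions force p - 1 ≤ jΦ, so with p≰jΦ, (p, q) = (⌊jΦ⌋ + 1, ⌊jΦ²⌋ + 1).
    pq-move-same-side : ∀ {n m a c t} → FloorΦ n a → FloorΦ m c →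
                        a ≡ c + suc t * p → a + n ≡ c + m + suc t * q → ⊥
    pq-move-same-side {n} {m} {c = c} {t} F G refl e =
      not-splitting (j , 0<j , p′ , p′ + j , Fj , floorNPhi⇒floorNPhi2 {j} {p′} Fj , inj₂ (refl , refl))
      where
      0<j = ℕ.+-cancelˡ-< p 0 j (subst (_< p + j) (sym (ℕ.+-identityʳ p)) p<q)
      regroup : ∀ c m T p j → c + m + T * (p + j) ≡ c + T * p + (m + T * j)
      regroup = solve-∀
      n≡m+T*j : n ≡ m + suc t * j
      n≡m+T*j = ℕ.+-cancelˡ-≡ (c + suc t * p) n (m + suc t * j) (trans e (regroup c m (suc t) p j))
      p′≤jΦ : p′ ≤Φ* j
      p′≤jΦ = ≤Φ*-cancel-* t (≤Φ*-antitoneˡ (ℕ.+-monoʳ-≤ p′ (ℕ.*-monoʳ-≤ t (ℕ.n≤1+n p′)))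
                (floorΦ-difference {d = p′ + t * p} F G refl n≡m+T*j))
      Fj = Equivalence.to (floorΦ⇔floorNPhi j p′) (mkFloorΦ p′≤jΦ p≰jΦ)

    pq-move-opposite-sides : ∀ {n m a c t} → FloorΦ n a → FloorΦ m c →
                             a ≡ c + m + suc t * p → a + n ≡ c + suc t * q → ⊥
    pq-move-opposite-sides {n} {m} {c = c} {t} F G refl e =
      p≰jΦ (≤Φ*-cancel-* t (≤Φ*-monoʳ n≤T*j (≤Φ*-antitoneˡ (ℕ.m≤n+m (suc t * p) (c + m)) (lower F))))
      where
      regroup₁ : ∀ c m x n → c + m + x + n ≡ c + x + (m + n)
      regroup₁ = solve-∀
      regroup₂ : ∀ c T p j → c + T * (p + j) ≡ c + T * p + T * j
      regroup₂ = solve-∀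
      n≤T*j : n ≤ suc t * j
      n≤T*j = subst (n ≤_) (ℕ.+-cancelˡ-≡ (c + suc t * p) (m + n) (suc t * j)
        (trans (sym (regroup₁ c m (suc t * p) n)) (trans e (regroup₂ c (suc t) p j)))) (ℕ.m≤n+m n m)

    pq-move-descending-ascending : ∀ {n m a c t} → a + n ≡ c + suc t * p → a ≡ c + m + suc t * q → ⊥
    pq-move-descending-ascending {n} {m} {c = c} {t} e refl = ℕ.<-irrefl refl (begin-strict
      c + suc t * p         <⟨ ℕ.+-monoʳ-< c (T*p<T*q t) ⟩
      c + suc t * q         ≤⟨ ℕ.+-monoˡ-≤ (suc t * q) (ℕ.m≤m+n c m) ⟩
      c + m + suc t * q     ≤⟨ ℕ.m≤m+n _ n ⟩
      c + m + suc t * q + n ≡⟨ e ⟩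
      c + suc t * p         ∎)

    pq-move-descending-descending : ∀ {n m a c t} → FloorΦ n a → FloorΦ m c →
                                    a + n ≡ c + m + suc t * p → a ≡ c + suc t * q → ⊥
    pq-move-descending-descending {n} {m} {c = c} {t} F G e refl with m ≤? n
    ... | yes m≤n = ℕ.<-irrefl refl (begin-strict
      c + m + suc t * p     <⟨ ℕ.+-monoʳ-< (c + m) (T*p<T*q t) ⟩
      c + m + suc t * q     ≡⟨ shuffle c m (suc t * q) ⟩
      c + suc t * q + m     ≤⟨ ℕ.+-monoʳ-≤ (c + suc t * q) m≤n ⟩
      c + suc t * q + n     ≡⟨ e ⟩
      c + m + suc t * p     ∎)
      where
      shuffle : ∀ c m x → c + m + x ≡ c + x + m
      shuffle = solve-∀
    ... | no  m≰n = ℕ.<⇒≱ (floorΦ-strictMono (ℕ.≰⇒> m≰n) F G) (ℕ.m≤m+n c (suc t * q))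

  wythoff-no-pq-move : ∀ {x y x′ y′ t} → Wythoff x y → Wythoff x′ y′ →
                       x ≡ x′ + suc t * p → y ≡ y′ + suc t * q → ⊥
  wythoff-no-pq-move {t = t} (ascending F)  (ascending G)  = pq-move-same-side {t = t} F G
  wythoff-no-pq-move {t = t} (ascending F)  (descending G) = pq-move-opposite-sides {t = t} F G
  wythoff-no-pq-move {t = t} (descending {n} F) (ascending {m} G) =
    pq-move-descending-ascending {n} {m} {t = t}
  wythoff-no-pq-move {t = t} (descending F) (descending G) = pq-move-descending-descending {t = t} F G

  gdwnMove-nonzero : ∀ {m n} → GDWNMove p q m n → 0 < m + n
  gdwnMove-nonzero (inj₁ (zero , () , _))
  gdwnMove-nonzero (inj₂ (zero , () , _))
  gdwnMove-nonzero (inj₁ (suc t , _ , inj₁ (refl , refl)))        = s≤s z≤n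
  gdwnMove-nonzero (inj₁ (suc t , _ , inj₂ (inj₁ (refl , refl)))) = s≤s z≤n
  gdwnMove-nonzero (inj₁ (suc t , _ , inj₂ (inj₂ (refl , refl)))) = s≤s z≤n
  gdwnMove-nonzero (inj₂ (suc t , _ , inj₁ (refl , refl)))        = s≤s z≤n
  gdwnMove-nonzero (inj₂ (suc t , _ , inj₂ (refl , refl)))        = s≤s z≤n

  wythoff-independent : ∀ {x y x′ y′} → Wythoff x y → Wythoff x′ y′ → ¬ Option (GDWNMove p q) x y x′ y′
  wythoff-independent W W′ (_ , _ , inj₁ (zero , () , _) , _)
  wythoff-independent W W′ (_ , _ , inj₂ (zero , () , _) , _)
  wythoff-independent W W′ (_ , _ , inj₁ (suc t , _ , inj₁ (refl , refl)) , ex , ey) =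
    wythoff-no-vertical W W′ (trans ex (ℕ.+-identityʳ _)) ey
  wythoff-independent W W′ (_ , _ , inj₁ (suc t , _ , inj₂ (inj₁ (refl , refl))) , ex , ey) =
    wythoff-no-vertical (wythoff-swap W) (wythoff-swap W′) (trans ey (ℕ.+-identityʳ _)) ex
  wythoff-independent W W′ (_ , _ , inj₁ (suc t , _ , inj₂ (inj₂ (refl , refl))) , ex , ey) =
    wythoff-no-diagonal W W′ ex ey
  wythoff-independent W W′ (_ , _ , inj₂ (suc t , _ , inj₁ (refl , refl)) , ex , ey) =
    wythoff-no-pq-move {t = t} W W′ ex ey
  wythoff-independent W W′ (_ , _ , inj₂ (suc t , _ , inj₂ (refl , refl)) , ex , ey) =
    wythoff-no-pq-move {t = t} (wythoff-swap W) (wythoff-swap W′) ey ex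

  IsP⇔Wythoff : ∀ x y → IsP (GDWNMove p q) x y ⇔ Wythoff x y
  IsP⇔Wythoff = kernel⇒IsP⇔ gdwnMove-nonzero record
    { independent = wythoff-independent
    ; absorbing   = λ x y → Sum.map₂ (λ (x′ , y′ , o , W) → x′ , y′ , Option-map inj₁ o , W)
                                     (wythoff-absorbing x y)
    }

proposition4p3 : (p q : ℕ) → 1 ≤ p → p < q → LtTimesPhi q p → ¬ SplittingPair p q →
    (x y : ℕ) → IsP (GDWNMove p q) x y ⇔ WythoffPairs x y
proposition4p3 (suc p′) q _ p<q q<pΦ not-splitting x y with ℕ.m≤n⇒∃[o]m+o≡n (ℕ.<⇒≤ p<q)
... | j , refl = ⇔-trans (GDWN.IsP⇔Wythoff p′ j p<q (ltTimesPhi⇒≤Φ* q<pΦ) not-splitting x y)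
                         (wythoff⇔wythoffPairs x y)
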